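{- If $H$ is a hypergraph with maximum vertex degree $\Delta$, then $b_L(H)\le |V(H)|-\left\lceil \frac{|E(H)|}{\Delta}\right\rceil$.
   Context: A hypergraph $H$ consists of a finite vertex set $V(H)$ and a finite collection $E(H)$ of nonempty subsets of $V(H)$. The degree of a vertex is the number of hyperedges containing it. Lazy burning: a set $B\subseteq V(H)$ is burned initially; in each subsequent round every unburned vertex $v$ for which some hyperedge $h\ni v$ has $h\setminus\{v\}$ entirely burned becomes burned. $B$ is a lazy burning set if eventually all vertices burn; $b_L(H)$ is the minimum size of a lazy burning set. -}

module Defs where

open import Data.Nat using (ℕ; zero; suc; _+_; _∸_; _/_; _⊔_)
open import Data.Fin using (Fin)
open import Data.Fin.Subset using (Subset; _∈_; Nonempty; ∣_∣)
open import Data.Fin.Subset.Properties using (_∈?_)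
open import Data.List using (List; length; filter; foldr; map; allFin)
open import Data.List.Relation.Unary.All using (All)
open import Data.List.Membership.Propositional using () renaming (_∈_ to _∈ₗ_)
open import Data.Product using (Σ; ∃; _×_)
open import Data.Sum using (_⊎_)
open import Relation.Binary.PropositionalEquality using (_≡_)
open import Relation.Nullary using (¬_)

-- A hypergraph on vertex set Fin n; E(H) is a finite collection (list, so
-- repeated hyperedges are allowed) of nonempty subsets of V(H).
record Hypergraph : Set where
  field
    n        : ℕ
    edges    : List (Subset n)
    nonempty : All Nonempty edges

open Hypergraph public

numEdges : Hypergraph → ℕ
numEdges H = length (edges H)

degree : (H : Hypergraph) → Fin (n H) → ℕ
degree H v = length (filter (v ∈?_) (edges H))

-- maximum vertex degree (0 if there are no vertices)
maxDegree : Hypergraph → ℕ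
maxDegree H = foldr _⊔_ 0 (map (degree H) (allFin (n H)))

-- ceiling division; convention ⌈ m / 0 ⌉ = 0 (only arises when |E| = 0)
ceilDiv : ℕ → ℕ → ℕ
ceilDiv m zero    = 0
ceilDiv m (suc d) = (m + d) / suc d

-- Lazy burning: Burned H B t v means v is burned after round t.
data Burned (H : Hypergraph) (B : Subset (n H)) : ℕ → Fin (n H) → Set where
  initial : ∀ {v} → v ∈ B → Burned H B 0 v
  stay    : ∀ {t v} → Burned H B t v → Burned H B (suc t) v
  spread  : ∀ {t v} (h : Subset (n H)) → h ∈ₗ edges H → v ∈ h →
            (∀ u → u ∈ h → ¬ (u ≡ v) → Burned H B t u) →
            Burned H B (suc t) v

IsLazyBurningSet : (H : Hypergraph) → Subset (n H) → Set
IsLazyBurningSet H B = ∃ λ t → ∀ v → Burned H B t v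

-- b_L(H) ≤ k  (b_L is the minimum size of a lazy burning set)
LazyBurningNumber≤ : Hypergraph → ℕ → Set
LazyBurningNumber≤ H k = Σ (Subset (n H)) λ B → IsLazyBurningSet H B × ∣ B ∣ Data.Nat.≤ k

-- Build greedily a list of pairs (x , h), x ∈ h ∈ E(H), whose vertices x
-- together meet every hyperedge and such that no later x lies in an earlier h:
-- scanning the hyperedges from the last, a hyperedge not met by the pairs
-- chosen so far is prepended together with any of its vertices.
-- Burning everything except these vertices, the pairs fire in order: once the
-- earlier x's are burned, all of h except x is burned, so x catches fire.
-- Each x lies in at most Δ hyperedges, so there are at least ⌈|E| / Δ⌉ pairs.

module Submission where

open import Defs
open import Data.Nat using (ℕ; zero; suc; _+_; _*_; _∸_; _⊔_; _≤_; z≤n; s≤s)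
open import Data.Nat.Properties
  using ( ≤-refl; ≤-reflexive; ≤-trans; ≤-pred; n≤1+n; +-comm; +-suc; +-identityʳ
        ; +-mono-≤; +-monoˡ-≤; +-monoʳ-≤; m≤m⊔n; m≤n⊔m; m+n≤o⇒m≤o∸n; ∸-monoʳ-≤; module ≤-Reasoning)
open import Data.Nat.DivMod using (m<n*o⇒m/o<n)
open import Data.Nat.ListAction using (sum)
open import Data.Fin using (Fin)
open import Data.Fin.Properties using (_≟_)
open import Data.Fin.Subset using (Subset; _∈_; _∉_; ∣_∣; ⊤; _-_)
open import Data.Fin.Subset.Properties using (_∈?_; ∈⊤; ∣⊤∣≡n; x∈p∧x≢y⇒x∈p-y; x∈p⇒∣p-x∣<∣p∣)
open import Data.List using (List; []; _∷_; length; filter; foldr; map)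
open import Data.List.Properties using (filter-accept)
open import Data.List.Relation.Unary.All as All using (All; []; _∷_)
open import Data.List.Relation.Unary.All.Properties using (¬Any⇒All¬)
open import Data.List.Relation.Unary.AllPairs using (AllPairs; []; _∷_)
open import Data.List.Relation.Unary.Any using (Any; here; there; any?)
open import Data.List.Membership.Propositional using () renaming (_∈_ to _∈ₗ_)
open import Data.List.Membership.Propositional.Properties using (∈-map⁺; ∈-allFin)
open import Data.List.Relation.Binary.Subset.Propositional using (_⊆_)
open import Data.Product using (∃; _×_; _,_; proj₁; proj₂)
open import Function using (id; _∘_)
open import Relation.Binary.PropositionalEquality using (_≢_; refl; sym; trans; subst)
open import Relation.Nullary using (yes; no)
open import Relation.Unary using (Decidable)

∈⇒≤foldr-⊔ : ∀ {m ms} → m ∈ₗ ms → m ≤ foldr _⊔_ 0 ms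
∈⇒≤foldr-⊔ (here refl) = m≤m⊔n _ _
∈⇒≤foldr-⊔ (there m∈ms) = ≤-trans (∈⇒≤foldr-⊔ m∈ms) (m≤n⊔m _ _)

sum-map-≤ : ∀ {a} {A : Set a} (f : A → ℕ) {m} → (∀ x → f x ≤ m) →
            ∀ xs → sum (map f xs) ≤ length xs * m
sum-map-≤ f f≤m []       = z≤n
sum-map-≤ f f≤m (x ∷ xs) = +-mono-≤ (f≤m x) (sum-map-≤ f f≤m xs)

m≤n*o⇒ceilDiv[m,o]≤n : ∀ {m n} o → m ≤ n * o → ceilDiv m o ≤ n
m≤n*o⇒ceilDiv[m,o]≤n zero    _ = z≤n
m≤n*o⇒ceilDiv[m,o]≤n {m} {n} (suc o) m≤n*o =
  ≤-pred (m<n*o⇒m/o<n {m + o} {suc n} (s≤s (begin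
    m + o          ≤⟨ +-monoˡ-≤ o m≤n*o ⟩
    n * suc o + o  ≡⟨ +-comm (n * suc o) o ⟩
    o + n * suc o  ∎)))
  where open ≤-Reasoning

module DoubleCounting {a b r} {A : Set a} {B : Set b} {R : A → B → Set r}
                      (R? : ∀ x → Decidable (R x)) where

  hits : A → List B → ℕ
  hits x ys = length (filter (R? x) ys)

  hits-∷ : ∀ x y ys → hits x ys ≤ hits x (y ∷ ys)
  hits-∷ x y ys with R? x y
  ... | yes _ = n≤1+n _
  ... | no  _ = ≤-refl

  sum-hits-∷ : ∀ {y} ys xs → Any (λ x → R x y) xs →
               suc (sum (map (λ x → hits x ys) xs)) ≤ sum (map (λ x → hits x (y ∷ ys)) xs)
  sum-hits-∷ {y} ys (x ∷ xs) (here Rxy)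
    rewrite filter-accept (R? x) {y} {ys} Rxy =
    s≤s (+-monoʳ-≤ (hits x ys) (sum-map-mono xs))
    where
    sum-map-mono : ∀ xs → sum (map (λ x → hits x ys) xs) ≤ sum (map (λ x → hits x (y ∷ ys)) xs)
    sum-map-mono []       = z≤n
    sum-map-mono (x ∷ xs) = +-mono-≤ (hits-∷ x y ys) (sum-map-mono xs)
  sum-hits-∷ {y} ys (x ∷ xs) (there hit) = begin
    suc (hits x ys + _)  ≡⟨ sym (+-suc (hits x ys) _) ⟩
    hits x ys + suc _    ≤⟨ +-mono-≤ (hits-∷ x y ys) (sum-hits-∷ ys xs hit) ⟩
    hits x (y ∷ ys) + _  ∎
    where open ≤-Reasoning

  length≤sum-hits : ∀ xs ys → All (λ y → Any (λ x → R x y) xs) ys →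
                    length ys ≤ sum (map (λ x → hits x ys) xs)
  length≤sum-hits xs []       []           = z≤n
  length≤sum-hits xs (y ∷ ys) (hit ∷ hits) =
    ≤-trans (s≤s (length≤sum-hits xs ys hits)) (sum-hits-∷ ys xs hit)

module Schedule (H : Hypergraph) where

  Vertex : Set
  Vertex = Fin (n H)

  IsSchedule : List (Vertex × Subset (n H)) → Set
  IsSchedule c = All (λ p → proj₂ p ∈ₗ edges H × proj₁ p ∈ proj₂ p) c
               × AllPairs (λ p q → proj₁ q ∉ proj₂ p) c

  Untargeted : Vertex → List (Vertex × Subset (n H)) → Set
  Untargeted v c = All (λ p → v ≢ proj₁ p) c

  untargeted : List (Vertex × Subset (n H)) → Subset (n H)
  untargeted []            = ⊤
  untargeted ((x , _) ∷ c) = untargeted c - x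

  Covers : List (Vertex × Subset (n H)) → List (Subset (n H)) → Set
  Covers c hs = All (λ h → Any (λ p → proj₁ p ∈ h) c) hs

  untargeted⁺ : ∀ {v} c → Untargeted v c → v ∈ untargeted c
  untargeted⁺ []       []          = ∈⊤
  untargeted⁺ (_ ∷ c) (v≢x ∷ v∉c) = x∈p∧x≢y⇒x∈p-y (untargeted⁺ c v∉c) v≢x

  untargeted-∉ : ∀ {u h} c → All (λ p → proj₁ p ∉ h) c → u ∈ h → Untargeted u c
  untargeted-∉ c avoid u∈h = All.map (λ { x∉h refl → x∉h u∈h }) avoid

  ∣untargeted∣+length≤n : ∀ c → IsSchedule c → ∣ untargeted c ∣ + length c ≤ n H
  ∣untargeted∣+length≤n [] _ = ≤-reflexive (trans (+-identityʳ _) (∣⊤∣≡n (n H)))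
  ∣untargeted∣+length≤n ((x , h) ∷ c) ((_ , x∈h) ∷ steps , avoid ∷ pairs) = begin
    ∣ untargeted c - x ∣ + suc (length c)  ≡⟨ +-suc _ (length c) ⟩
    suc ∣ untargeted c - x ∣ + length c    ≤⟨ +-monoˡ-≤ (length c) ∣untargeted-x∣<∣untargeted∣ ⟩
    ∣ untargeted c ∣ + length c            ≤⟨ ∣untargeted∣+length≤n c (steps , pairs) ⟩
    n H                                     ∎
    where
    open ≤-Reasoning
    ∣untargeted-x∣<∣untargeted∣ : suc ∣ untargeted c - x ∣ ≤ ∣ untargeted c ∣
    ∣untargeted-x∣<∣untargeted∣ = x∈p⇒∣p-x∣<∣p∣ (untargeted⁺ c (untargeted-∉ c avoid x∈h))

  schedule-burns : ∀ {B s} c → IsSchedule c → (∀ v → Untargeted v c → Burned H B s v) →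
                   ∀ v → Burned H B (length c + s) v
  schedule-burns [] _ burned v = burned v []
  schedule-burns {B} {s} ((x , h) ∷ c) ((h∈E , x∈h) ∷ steps , avoid ∷ pairs) burned v =
    subst (λ t → Burned H B t v) (+-suc (length c) s) (schedule-burns c (steps , pairs) burned′ v)
    where
    burned′ : ∀ w → Untargeted w c → Burned H B (suc s) w
    burned′ w w∉c with w ≟ x
    ... | yes refl = spread h h∈E x∈h (λ u u∈h u≢x → burned u (u≢x ∷ untargeted-∉ c avoid u∈h))
    ... | no  w≢x  = stay (burned w (w≢x ∷ w∉c))

  untargeted-isLazyBurningSet : ∀ c → IsSchedule c → IsLazyBurningSet H (untargeted c)
  untargeted-isLazyBurningSet c sched =
    length c + 0 , schedule-burns c sched (λ v v∉c → initial (untargeted⁺ c v∉c))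

  covering-schedule : ∀ hs → hs ⊆ edges H → ∃ λ c → IsSchedule c × Covers c hs
  covering-schedule []       _     = [] , ([] , []) , []
  covering-schedule (h ∷ hs) hs⊆E with covering-schedule hs (hs⊆E ∘ there)
  ... | c , (steps , pairs) , covers with any? (λ p → proj₁ p ∈? h) c
  ...   | yes hit  = c , (steps , pairs) , hit ∷ covers
  ...   | no  miss =
    (x , h) ∷ c , ((h∈E , x∈h) ∷ steps , ¬Any⇒All¬ c miss ∷ pairs) , here x∈h ∷ All.map there covers
    where
    h∈E : h ∈ₗ edges H
    h∈E = hs⊆E (here refl)

    x : Vertex
    x = proj₁ (All.lookup (nonempty H) h∈E)

    x∈h : x ∈ h
    x∈h = proj₂ (All.lookup (nonempty H) h∈E)

  degree≤maxDegree : ∀ v → degree H v ≤ maxDegree H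
  degree≤maxDegree v = ∈⇒≤foldr-⊔ (∈-map⁺ (degree H) (∈-allFin v))

  numEdges≤length*maxDegree : ∀ c → Covers c (edges H) → numEdges H ≤ length c * maxDegree H
  numEdges≤length*maxDegree c covers =
    ≤-trans (length≤sum-hits c (edges H) covers) (sum-map-≤ _ (degree≤maxDegree ∘ proj₁) c)
    where open DoubleCounting (λ p → proj₁ p ∈?_)

theorem2p15 : (H : Hypergraph) →
    LazyBurningNumber≤ H (n H ∸ ceilDiv (numEdges H) (maxDegree H))
theorem2p15 H =
  let open Schedule H
      c , sched , covers = covering-schedule (edges H) id
  in untargeted c , untargeted-isLazyBurningSet c sched ,
     ≤-trans (m+n≤o⇒m≤o∸n ∣ untargeted c ∣ (∣untargeted∣+length≤n c sched))
             (∸-monoʳ-≤ (n H) (m≤n*o⇒ceilDiv[m,o]≤n {n = length c} (maxDegree H)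
                                  (numEdges≤length*maxDegree c covers)))
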